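{- Let $k\ge 1$. If $G$ is a $3$-partite graph that can be partitioned into slices each of clique-width at most $k$, then $G$ has clique-width at most $\max(3k,6)$.
   Context: Let $G$ be a graph whose vertex set is partitioned into three (possibly empty) independent sets $V_1,V_2,V_3$. $G$ can be partitioned into slices if each $V_i$ can be partitioned into sets $V_i^0,\dots,V_i^\ell$ (same $\ell$ for all $i$) such that, with subscripts of the $V_i$ taken modulo $3$, for every $i\in\{1,2,3\}$ and all $0\le j<k\le\ell$, the set $V_i^j$ is complete (every vertex adjacent to every vertex) to $V_{i+1}^k$ and anti-complete (no edges) to $V_{i+2}^k$. The slices are the graphs $G^j=G[V_1^j\cup V_2^j\cup V_3^j]$, $j=0,\dots,\ell$. Clique-width is the minimum number of labels needed to construct the graph using vertex creation with a label, disjoint union, joining all vertices of label $i$ to all vertices of label $j\ne i$, and relabelling $i$ to $j$. -}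

module Defs where

open import Data.Nat using (ℕ; zero; suc; _+_; _*_; _⊔_; _≥_)
open import Data.Fin using (Fin; zero; suc; splitAt; _≟_; _<_)
open import Data.Bool using (Bool; true; false; _∧_; _∨_; if_then_else_)
open import Data.Sum using (_⊎_; inj₁; inj₂)
open import Data.Product using (Σ; _×_; ∃; ∃-syntax; _,_)
open import Data.Unit using (⊤)
open import Relation.Nullary using (¬_; Dec; yes; no)
open import Relation.Nullary.Decidable using (⌊_⌋)
open import Relation.Binary.PropositionalEquality using (_≡_; _≢_)

record Graph : Set where
  field
    n      : ℕ
    adj    : Fin n → Fin n → Bool
    sym    : ∀ u v → adj u v ≡ adj v u
    irrefl : ∀ v → adj v v ≡ false
open Graph public

data Expr (k : ℕ) : ℕ → Set where
  ε     : Expr k 0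
  vtx   : Fin k → Expr k 1
  _⊕_   : ∀ {m n} → Expr k m → Expr k n → Expr k (m + n)
  join  : ∀ {n} (i j : Fin k) → i ≢ j → Expr k n → Expr k n
  relab : ∀ {n} (i j : Fin k) → Expr k n → Expr k n

_==_ : ∀ {k} → Fin k → Fin k → Bool
a == b = ⌊ a ≟ b ⌋

label : ∀ {k n} → Expr k n → Fin n → Fin k
label (vtx i) x = i
label (_⊕_ {m} e f) x with splitAt m x
... | inj₁ y = label e y
... | inj₂ y = label f y
label (join i j _ e) x = label e x
label (relab i j e) x = if label e x == i then j else label e x

edge : ∀ {k n} → Expr k n → Fin n → Fin n → Bool
edge ε x y = false
edge (vtx i) x y = false
edge (_⊕_ {m} e f) x y with splitAt m x | splitAt m y
... | inj₁ a | inj₁ b = edge e a b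
... | inj₂ a | inj₂ b = edge f a b
... | _      | _      = false
edge (join i j _ e) x y =
  edge e x y
  ∨ ((label e x == i) ∧ (label e y == j))
  ∨ ((label e x == j) ∧ (label e y == i))
edge (relab i j e) x y = edge e x y

InducedCW≤ : (G : Graph) → (Fin (n G) → Set) → ℕ → Set
InducedCW≤ G S k =
  Σ ℕ λ m → Σ (Expr k m) λ e → Σ (Fin m → Fin (n G)) λ f →
      (∀ x y → f x ≡ f y → x ≡ y)
    × (∀ x → S (f x))
    × (∀ v → S v → ∃[ x ] f x ≡ v)
    × (∀ x y → edge e x y ≡ adj G (f x) (f y))

CW≤ : Graph → ℕ → Set
CW≤ G k = InducedCW≤ G (λ _ → ⊤) k

s3 : Fin 3 → Fin 3
s3 zero = suc zero
s3 (suc zero) = suc (suc zero)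
s3 (suc (suc zero)) = zero

IsTripartition : (G : Graph) → (Fin (n G) → Fin 3) → Set
IsTripartition G part = ∀ u v → part u ≡ part v → adj G u v ≡ false

IsSlicePartition : (G : Graph) → (Fin (n G) → Fin 3) → (ℓ : ℕ) →
                   (Fin (n G) → Fin (suc ℓ)) → Set
IsSlicePartition G part ℓ slice =
  ∀ u v → slice u < slice v →
      (part v ≡ s3 (part u) → adj G u v ≡ true)
    × (part v ≡ s3 (s3 (part u)) → adj G u v ≡ false)

-- The expression for G is assembled slice by slice with labels (i , a) ∈ Fin 3 × Fin (k ⊔ 2), that is
-- 3 (k ⊔ 2) = 3k ⊔ 6 labels.  A k-expression for a slice is simulated with each label refined by the
-- part V_i of its vertex (labels (i , a) with a < k), after which every vertex of the slice is relabelled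
-- to (i , 0).  The slices assembled so far carry the labels (i , 1).  Each earlier vertex of V_i is complete
-- to the new vertices of V_{i+1} and anticomplete to the rest of the new slice, so joining (i + 1 , 0) with
-- (i , 1) for every i adds exactly the edges between the old part and the new slice; relabelling (i , 0) to
-- (i , 1) then restores the invariant.

module Submission where

open import Defs hiding (sym)
open import Algebra.Bundles using (CommutativeMonoid)
open import Data.Bool using (Bool; true; false; T; _∧_; _∨_; if_then_else_)
open import Data.Bool.ListAction using (any)
open import Data.Bool.Properties using (∨-identityʳ; ∧-comm; if-float; T-∧; ∨-commutativeMonoid)
open import Algebra.Properties.CommutativeSemigroup (CommutativeMonoid.commutativeSemigroup ∨-commutativeMonoid)
  using () renaming (interchange to ∨-interchange; xy∙z≈x∙zy to ∨-xy∙z≈x∙zy)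
open import Data.Empty using (⊥; ⊥-elim)
open import Data.Fin using (Fin; zero; suc; _≟_; _<_; toℕ; fromℕ<; splitAt; _↑ˡ_; _↑ʳ_; inject≤; combine)
open import Data.Fin.Patterns using (0F; 1F; 2F)
open import Data.Fin.Properties
  using (splitAt⁻¹-↑ˡ; splitAt⁻¹-↑ʳ; splitAt-↑ˡ; splitAt-↑ʳ; inject≤-injective; combine-injective;
         toℕ-fromℕ<; toℕ-injective; toℕ<n)
open import Data.List using (List; []; _∷_; foldr; cartesianProduct; allFin)
open import Data.List.Membership.Propositional using (_∈_; lose)
open import Data.List.Membership.Propositional.Properties using (∈-cartesianProduct⁺; ∈-allFin)
open import Data.List.Relation.Unary.Any using (here; there; satisfied)
open import Data.List.Relation.Unary.Any.Properties using (any⁺; any⁻)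
open import Data.Nat using (ℕ; zero; suc; _+_; _*_; _⊔_; _≤_; _≥_) renaming (_<_ to _<ℕ_)
open import Data.Nat.Properties
  using (m≤m⊔n; m≤n⊔m; ≤-refl; <⇒≤; ≤-reflexive; <-irrefl; *-distribˡ-⊔; m<n⇒m<1+n; m<1+n⇒m<n∨m≡n)
open import Data.Product using (_×_; _,_; proj₁; proj₂; ∃-syntax)
open import Data.Product.Properties using (≡-dec)
open import Data.Sum using (_⊎_; inj₁; inj₂; [_,_]′; map₂)
open import Data.Unit using (tt)
open import Function using (_∘_; Equivalence)
open import Function.Definitions using (Injective)
open import Relation.Binary.Definitions using (DecidableEquality)
open import Relation.Binary.PropositionalEquality
open import Relation.Nullary using (yes; no; contradiction)
open import Relation.Nullary.Decidable using (⌊_⌋; toWitness; fromWitness)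
open ≡-Reasoning

T-injective : ∀ {a b} → (T a → T b) → (T b → T a) → a ≡ b
T-injective {false} {false} _ _ = refl
T-injective {false} {true}  _ b⇒a = contradiction (b⇒a _) λ ()
T-injective {true}  {false} a⇒b _ = contradiction (a⇒b _) λ ()
T-injective {true}  {true}  _ _ = refl

⌊≟⌋-injective : ∀ {A B : Set} (_≟ᴬ_ : DecidableEquality A) (_≟ᴮ_ : DecidableEquality B)
                {f : A → B} → Injective _≡_ _≡_ f →
                ∀ a b → ⌊ f a ≟ᴮ f b ⌋ ≡ ⌊ a ≟ᴬ b ⌋
⌊≟⌋-injective _≟ᴬ_ _≟ᴮ_ {f} f-injective a b with f a ≟ᴮ f b | a ≟ᴬ b
... | yes _   | yes _   = refl
... | no  _   | no  _   = refl
... | yes fab | no  a≢b = contradiction (f-injective fab) a≢b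
... | no  fa≢fb | yes ab = contradiction (cong f ab) fa≢fb

any-∨ : ∀ {A : Set} (f g : A → Bool) xs → any (λ a → f a ∨ g a) xs ≡ any f xs ∨ any g xs
any-∨ f g []       = refl
any-∨ f g (a ∷ xs) = begin
  (f a ∨ g a) ∨ any (λ a → f a ∨ g a) xs ≡⟨ cong ((f a ∨ g a) ∨_) (any-∨ f g xs) ⟩
  (f a ∨ g a) ∨ (any f xs ∨ any g xs)     ≡⟨ ∨-interchange (f a) (g a) (any f xs) (any g xs) ⟩
  (f a ∨ any f xs) ∨ (g a ∨ any g xs)     ∎

module _ {A B : Set} (_≟ᴬ_ : DecidableEquality A) (_≟ᴮ_ : DecidableEquality B) where

  pick : (A → B → Bool) → A → B → A × B → Bool
  pick R a b (a′ , b′) = R a′ b′ ∧ (⌊ a ≟ᴬ a′ ⌋ ∧ ⌊ b ≟ᴮ b′ ⌋)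

  any-pick : ∀ R {a b} ps → (a , b) ∈ ps → any (pick R a b) ps ≡ R a b
  any-pick R {a} {b} ps ab∈ps = T-injective sound complete
    where
    sound : T (any (pick R a b) ps) → T (R a b)
    sound t with satisfied (any⁻ _ ps t)
    ... | (a′ , b′) , p with Equivalence.to (T-∧ {R a′ b′}) p
    ...   | r , eqs with Equivalence.to (T-∧ {⌊ a ≟ᴬ a′ ⌋}) eqs
    ...     | a≡a′ , b≡b′ rewrite toWitness a≡a′ | toWitness b≡b′ = r
    complete : T (R a b) → T (any (pick R a b) ps)
    complete r = any⁺ _ (lose ab∈ps (Equivalence.from (T-∧ {R a b}) (r , diagonal)))
      where
      diagonal : T (⌊ a ≟ᴬ a ⌋ ∧ ⌊ b ≟ᴮ b ⌋)
      diagonal = Equivalence.from T-∧ (fromWitness {a? = a ≟ᴬ a} refl , fromWitness {a? = b ≟ᴮ b} refl)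

[,]′∘splitAt-injective : ∀ {A : Set} {m n} {f : Fin m → A} {g : Fin n → A} →
                         (∀ a a′ → f a ≡ f a′ → a ≡ a′) → (∀ b b′ → g b ≡ g b′ → b ≡ b′) →
                         (∀ a b → f a ≢ g b) →
                         ∀ x y → [ f , g ]′ (splitAt m x) ≡ [ f , g ]′ (splitAt m y) → x ≡ y
[,]′∘splitAt-injective {m = m} {n} f-inj g-inj f≢g x y eq
  with splitAt m x in split-x | splitAt m y in split-y
... | inj₁ a | inj₁ a′ = trans (sym (splitAt⁻¹-↑ˡ split-x))
                           (trans (cong (_↑ˡ n) (f-inj a a′ eq)) (splitAt⁻¹-↑ˡ split-y))
... | inj₂ b | inj₂ b′ = trans (sym (splitAt⁻¹-↑ʳ split-x))
                           (trans (cong (m ↑ʳ_) (g-inj b b′ eq)) (splitAt⁻¹-↑ʳ split-y))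
... | inj₁ a | inj₂ b  = contradiction eq (f≢g a b)
... | inj₂ b | inj₁ a  = contradiction (sym eq) (f≢g a b)

module Labelling {A : Set} (_≟ᴬ_ : DecidableEquality A) (labels : List A)
                 (∈-labels : ∀ a → a ∈ labels)
                 {L : ℕ} (ι : A → Fin L) (ι-injective : Injective _≡_ _≡_ ι) where

  labelPairs : List (A × A)
  labelPairs = cartesianProduct labels labels

  -- A record rather than a function type, so that e and lab can be inferred from a proof.
  record _HasLabels_ {m} (e : Expr L m) (lab : Fin m → A) : Set where
    constructor hasLabels
    field label≡ : ∀ x → label e x ≡ ι (lab x)
  open _HasLabels_ public

  label-== : ∀ {m} (e : Expr L m) {lab} → e HasLabels lab →
             ∀ x a → (label e x == ι a) ≡ ⌊ lab x ≟ᴬ a ⌋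
  label-== e {lab} e-lab x a =
    trans (cong (_== ι a) (label≡ e-lab x)) (⌊≟⌋-injective _≟ᴬ_ _≟_ ι-injective (lab x) a)

  ⊕-HasLabels : ∀ {m n} {e : Expr L m} {f : Expr L n} {lab₁ lab₂} →
                e HasLabels lab₁ → f HasLabels lab₂ → (e ⊕ f) HasLabels ([ lab₁ , lab₂ ]′ ∘ splitAt m)
  ⊕-HasLabels {m} {e = e} {f} {lab₁} {lab₂} e-lab f-lab = hasLabels ⊕-label
    where
    ⊕-label : ∀ x → label (e ⊕ f) x ≡ ι ([ lab₁ , lab₂ ]′ (splitAt m x))
    ⊕-label x with splitAt m x
    ... | inj₁ y = label≡ e-lab y
    ... | inj₂ y = label≡ f-lab y

  module Joins (R : A → A → Bool) (R-irrefl : ∀ a → R a a ≡ false) where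

    related⇒ι≢ : ∀ a b → R a b ≡ true → ι a ≢ ι b
    related⇒ι≢ a b Rab ιa≡ιb with refl ← ι-injective ιa≡ιb =
      contradiction (trans (sym Rab) (R-irrefl a)) λ ()

    joinWhen : ∀ {m} a b (c : Bool) → (c ≡ true → ι a ≢ ι b) → Expr L m → Expr L m
    joinWhen a b false _        e = e
    joinWhen a b true  ιa≢ιb e = join (ι a) (ι b) (ιa≢ιb refl) e

    joinPair : ∀ {m} → A × A → Expr L m → Expr L m
    joinPair (a , b) = joinWhen a b (R a b) (related⇒ι≢ a b)

    joinAll : ∀ {m} → Expr L m → Expr L m
    joinAll e = foldr joinPair e labelPairs

    label-joinPair : ∀ {m} p (e : Expr L m) x → label (joinPair p e) x ≡ label e x
    label-joinPair (a , b) e x with R a b | related⇒ι≢ a b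
    ... | false | _ = refl
    ... | true  | _ = refl

    label-joinPairs : ∀ {m} ps (e : Expr L m) x → label (foldr joinPair e ps) x ≡ label e x
    label-joinPairs []       e x = refl
    label-joinPairs (p ∷ ps) e x = trans (label-joinPair p _ x) (label-joinPairs ps e x)

    joinPairs-HasLabels : ∀ {m} ps {e : Expr L m} {lab} → e HasLabels lab → foldr joinPair e ps HasLabels lab
    joinPairs-HasLabels ps {e} e-lab = hasLabels λ x → trans (label-joinPairs ps e x) (label≡ e-lab x)

    joinAll-HasLabels : ∀ {m} {e : Expr L m} {lab} → e HasLabels lab → joinAll e HasLabels lab
    joinAll-HasLabels = joinPairs-HasLabels labelPairs

    module _ {m} {lab : Fin m → A} (x y : Fin m) where

      links : A × A → Bool
      links p = pick _≟ᴬ_ _≟ᴬ_ R (lab x) (lab y) p ∨ pick _≟ᴬ_ _≟ᴬ_ R (lab y) (lab x) p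

      edge-joinPair : ∀ p {e : Expr L m} → e HasLabels lab →
                      edge (joinPair p e) x y ≡ edge e x y ∨ links p
      edge-joinPair (a , b) {e} e-lab with R a b | related⇒ι≢ a b
      ... | false | _ = sym (∨-identityʳ (edge e x y))
      ... | true  | _ = cong (edge e x y ∨_) (cong₂ _∨_
            (cong₂ _∧_ (label-== e e-lab x a) (label-== e e-lab y b))
            (trans (∧-comm (label e x == ι b) _)
                   (cong₂ _∧_ (label-== e e-lab y a) (label-== e e-lab x b))))

      edge-joinPairs : ∀ ps {e : Expr L m} → e HasLabels lab →
                       edge (foldr joinPair e ps) x y ≡ edge e x y ∨ any links ps
      edge-joinPairs []       {e} e-lab = sym (∨-identityʳ (edge e x y))
      edge-joinPairs (p ∷ ps) {e} e-lab = begin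
        edge (joinPair p e′) x y        ≡⟨ edge-joinPair p (joinPairs-HasLabels ps e-lab) ⟩
        edge e′ x y ∨ links p           ≡⟨ cong (_∨ links p) (edge-joinPairs ps e-lab) ⟩
        (edge e x y ∨ rest) ∨ links p   ≡⟨ ∨-xy∙z≈x∙zy (edge e x y) rest (links p) ⟩
        edge e x y ∨ any links (p ∷ ps) ∎
        where
        e′ = foldr joinPair e ps
        rest = any links ps

    edge-joinAll : ∀ {m} {e : Expr L m} {lab} → e HasLabels lab → ∀ x y →
                   edge (joinAll e) x y ≡ edge e x y ∨ (R (lab x) (lab y) ∨ R (lab y) (lab x))
    edge-joinAll {e = e} {lab} e-lab x y = begin
      edge (joinAll e) x y                                 ≡⟨ edge-joinPairs x y labelPairs e-lab ⟩
      E ∨ any (links x y) labelPairs                       ≡⟨ cong (E ∨_) (any-∨ _ _ labelPairs) ⟩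
      E ∨ (any (pick′ x y) labelPairs ∨ any (pick′ y x) labelPairs)
                                                           ≡⟨ cong (E ∨_) (cong₂ _∨_ (any-pick′ x y) (any-pick′ y x)) ⟩
      E ∨ (R (lab x) (lab y) ∨ R (lab y) (lab x))          ∎
      where
      E = edge e x y
      pick′ : Fin _ → Fin _ → A × A → Bool
      pick′ x y = pick _≟ᴬ_ _≟ᴬ_ R (lab x) (lab y)
      any-pick′ : ∀ x y → any (pick′ x y) labelPairs ≡ R (lab x) (lab y)
      any-pick′ x y = any-pick _≟ᴬ_ _≟ᴬ_ R labelPairs (∈-cartesianProduct⁺ (∈-labels (lab x)) (∈-labels (lab y)))

  -- Labels are moved one at a time, so a vertex already moved from a to g a is hit again by the step
  -- for g a; idempotence of g makes that harmless.
  module Relabelling (g : A → A) (g-idem : ∀ a → g (g a) ≡ g a) where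

    relabelStep : A → A → A
    relabelStep a w = if ⌊ w ≟ᴬ a ⌋ then g a else w

    relabels : ∀ {m} → List A → Expr L m → Expr L m
    relabels as e = foldr (λ a → relab (ι a) (ι (g a))) e as

    relabelAll : ∀ {m} → Expr L m → Expr L m
    relabelAll = relabels labels

    relabelStep-fixes-g : ∀ a w → relabelStep a (g w) ≡ g w
    relabelStep-fixes-g a w with g w ≟ᴬ a
    ... | yes refl = g-idem w
    ... | no  _    = refl

    relabelSteps-orbit : ∀ w as → foldr relabelStep w as ≡ w ⊎ foldr relabelStep w as ≡ g w
    relabelSteps-orbit w []       = inj₁ refl
    relabelSteps-orbit w (a ∷ as) with foldr relabelStep w as | relabelSteps-orbit w as
    ... | _ | inj₂ refl = inj₂ (relabelStep-fixes-g a w)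
    ... | _ | inj₁ refl with w ≟ᴬ a
    ...   | yes refl = inj₂ refl
    ...   | no  _    = inj₁ refl

    relabelSteps-∈ : ∀ {w as} → w ∈ as → foldr relabelStep w as ≡ g w
    relabelSteps-∈ {w} (here {xs = as} refl) with foldr relabelStep w as | relabelSteps-orbit w as
    ... | _ | inj₂ refl = relabelStep-fixes-g w w
    ... | _ | inj₁ refl with w ≟ᴬ w
    ...   | yes _   = refl
    ...   | no  w≢w = contradiction refl w≢w
    relabelSteps-∈ {w} (there {x = a} w∈as) rewrite relabelSteps-∈ w∈as = relabelStep-fixes-g a w

    label-relabels : ∀ {m} {e : Expr L m} {lab} → e HasLabels lab → ∀ as x →
                     label (relabels as e) x ≡ ι (foldr relabelStep (lab x) as)
    label-relabels e-lab []       x = label≡ e-lab x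
    label-relabels {e = e} {lab} e-lab (a ∷ as) x = begin
      (if label e′ x == ι a then ι (g a) else label e′ x) ≡⟨ cong (λ l → if l == ι a then ι (g a) else l)
                                                               (label-relabels e-lab as x) ⟩
      (if ι r == ι a then ι (g a) else ι r)               ≡⟨ cong (λ c → if c then ι (g a) else ι r)
                                                               (⌊≟⌋-injective _≟ᴬ_ _≟_ ι-injective r a) ⟩
      (if ⌊ r ≟ᴬ a ⌋ then ι (g a) else ι r)               ≡⟨ if-float ι ⌊ r ≟ᴬ a ⌋ ⟨
      ι (relabelStep a r)                                 ∎
      where
      e′ = relabels as e
      r = foldr relabelStep (lab x) as

    relabelAll-HasLabels : ∀ {m} {e : Expr L m} {lab} → e HasLabels lab → relabelAll e HasLabels (g ∘ lab)
    relabelAll-HasLabels {lab = lab} e-lab = hasLabels λ x →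
      trans (label-relabels e-lab labels x) (cong ι (relabelSteps-∈ (∈-labels (lab x))))

    edge-relabels : ∀ {m} (e : Expr L m) as x y → edge (relabels as e) x y ≡ edge e x y
    edge-relabels e []       x y = refl
    edge-relabels e (a ∷ as) x y = edge-relabels e as x y

    edge-relabelAll : ∀ {m} (e : Expr L m) x y → edge (relabelAll e) x y ≡ edge e x y
    edge-relabelAll e = edge-relabels e labels

module FinPairLabelling {c k L : ℕ} (ι : Fin c × Fin k → Fin L) (ι-injective : Injective _≡_ _≡_ ι) =
  Labelling (≡-dec _≟_ _≟_) (cartesianProduct (allFin c) (allFin k))
            (λ (p , a) → ∈-cartesianProduct⁺ (∈-allFin p) (∈-allFin a)) ι ι-injective

module Refinement {c k L : ℕ} (ι : Fin c × Fin k → Fin L) (ι-injective : Injective _≡_ _≡_ ι) where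
  open FinPairLabelling ι ι-injective

  between : Fin k → Fin k → Fin c × Fin k → Fin c × Fin k → Bool
  between i j (_ , a) (_ , b) = (a == i) ∧ (b == j)

  between-irrefl : ∀ {i j} → i ≢ j → ∀ p → between i j p p ≡ false
  between-irrefl {i} {j} i≢j (_ , a) with a ≟ i | a ≟ j
  ... | no  _    | _        = refl
  ... | yes _    | no _     = refl
  ... | yes refl | yes refl = contradiction refl i≢j

  rename : Fin k → Fin k → Fin c × Fin k → Fin c × Fin k
  rename i j (p , a) = p , (if a == i then j else a)

  rename-idem : ∀ i j p → rename i j (rename i j p) ≡ rename i j p
  rename-idem i j (p , a) with a ≟ i
  ... | yes _ with j ≟ i
  ...   | yes _ = refl
  ...   | no  _ = refl
  rename-idem i j (p , a) | no a≢i with a ≟ i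
  ...   | yes a≡i = contradiction a≡i a≢i
  ...   | no  _   = refl

  refine : ∀ {m} → Expr k m → (Fin m → Fin c) → Expr L m
  refine ε                   π = ε
  refine (vtx i)             π = vtx (ι (π zero , i))
  refine (_⊕_ {m} {n} e f)   π = refine e (π ∘ (_↑ˡ n)) ⊕ refine f (π ∘ (m ↑ʳ_))
  refine (join i j i≢j e)    π = Joins.joinAll (between i j) (between-irrefl i≢j) (refine e π)
  refine (relab i j e)       π = Relabelling.relabelAll (rename i j) (rename-idem i j) (refine e π)

  label-refine : ∀ {m} (e : Expr k m) π x → label (refine e π) x ≡ ι (π x , label e x)
  label-refine (vtx i) π zero = refl
  label-refine (_⊕_ {m} {n} e f) π x with splitAt m x in split
  ... | inj₁ y = trans (label-refine e _ y) (cong (λ z → ι (π z , label e y)) (splitAt⁻¹-↑ˡ split))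
  ... | inj₂ y = trans (label-refine f _ y) (cong (λ z → ι (π z , label f y)) (splitAt⁻¹-↑ʳ split))
  label-refine (join i j i≢j e) π = label≡
    (Joins.joinAll-HasLabels (between i j) (between-irrefl i≢j) (hasLabels (label-refine e π)))
  label-refine (relab i j e) π = label≡
    (Relabelling.relabelAll-HasLabels (rename i j) (rename-idem i j) (hasLabels (label-refine e π)))

  refine-HasLabels : ∀ {m} (e : Expr k m) π → refine e π HasLabels (λ x → π x , label e x)
  refine-HasLabels e π = hasLabels (label-refine e π)

  edge-refine : ∀ {m} (e : Expr k m) π x y → edge (refine e π) x y ≡ edge e x y
  edge-refine ε       π x y = refl
  edge-refine (vtx i) π x y = refl
  edge-refine (_⊕_ {m} e f) π x y with splitAt m x | splitAt m y
  ... | inj₁ a | inj₁ b = edge-refine e _ a b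
  ... | inj₂ a | inj₂ b = edge-refine f _ a b
  ... | inj₁ _ | inj₂ _ = refl
  ... | inj₂ _ | inj₁ _ = refl
  edge-refine (join i j i≢j e) π x y = begin
    edge (Joins.joinAll R R-irrefl (refine e π)) x y
      ≡⟨ Joins.edge-joinAll R R-irrefl (refine-HasLabels e π) x y ⟩
    edge (refine e π) x y ∨ ((lx == i) ∧ (ly == j) ∨ (ly == i) ∧ (lx == j))
      ≡⟨ cong₂ (λ a b → a ∨ (lx == i) ∧ (ly == j) ∨ b) (edge-refine e π x y) (∧-comm (ly == i) (lx == j)) ⟩
    edge e x y ∨ (lx == i) ∧ (ly == j) ∨ (lx == j) ∧ (ly == i)
      ∎
    where
    R = between i j
    R-irrefl = between-irrefl i≢j
    lx = label e x
    ly = label e y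
  edge-refine (relab i j e) π x y =
    trans (Relabelling.edge-relabelAll (rename i j) (rename-idem i j) (refine e π) x y) (edge-refine e π x y)

module Assembly (k : ℕ) (G : Graph) (part : Fin (n G) → Fin 3) where

  K = k ⊔ 2
  L = 3 * k ⊔ 6

  ι : Fin 3 × Fin K → Fin L
  ι (p , a) = inject≤ (combine p a) (≤-reflexive (*-distribˡ-⊔ 3 k 2))

  ι-injective : Injective _≡_ _≡_ ι
  ι-injective {p , a} {q , b} eq with combine-injective p a q b (inject≤-injective _ _ _ _ eq)
  ... | refl , refl = refl

  widen : ∀ {r} → r ≤ K → Fin 3 × Fin r → Fin L
  widen r≤K (p , a) = ι (p , inject≤ a r≤K)

  widen-injective : ∀ {r} (r≤K : r ≤ K) → Injective _≡_ _≡_ (widen r≤K)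
  widen-injective r≤K {p , a} {q , b} eq =
    cong₂ _,_ (cong proj₁ ι-eq) (inject≤-injective r≤K r≤K a b (cong proj₂ ι-eq))
    where ι-eq = ι-injective {p , inject≤ a r≤K} {q , inject≤ b r≤K} eq

  ι-slice = widen (m≤m⊔n k 2)
  ι-stage = widen (m≤n⊔m k 2)

  open Refinement ι-slice (widen-injective (m≤m⊔n k 2)) using (refine; label-refine; edge-refine)
  module Wide  = FinPairLabelling ι ι-injective
  module Stage = FinPairLabelling ι-stage (widen-injective (m≤n⊔m k 2))

  attach : Fin 3 × Fin 2 → Fin 3 × Fin 2 → Bool
  attach (p , 0F) (q , 1F) = p == s3 q
  attach _        _        = false

  attach-irrefl : ∀ p → attach p p ≡ false
  attach-irrefl (_ , 0F) = refl
  attach-irrefl (_ , 1F) = refl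

  record Built (S : Fin (n G) → Set) (s : Fin 2) : Set where
    field
      {size}           : ℕ
      expr             : Expr L size
      vertex           : Fin size → Fin (n G)
      vertex-injective : ∀ x y → vertex x ≡ vertex y → x ≡ y
      vertex-∈         : ∀ x → S (vertex x)
      vertex-onto      : ∀ v → S v → ∃[ x ] vertex x ≡ v
      edge-adj         : ∀ x y → edge expr x y ≡ adj G (vertex x) (vertex y)
      labelled         : expr Stage.HasLabels (λ x → part (vertex x) , s)

  Built⇒InducedCW≤ : ∀ {S s} → Built S s → InducedCW≤ G S L
  Built⇒InducedCW≤ B = size , expr , vertex , vertex-injective , vertex-∈ , vertex-onto , edge-adj
    where open Built B

  Built-resp : ∀ {S S′ s} → (∀ v → S v → S′ v) → (∀ v → S′ v → S v) → Built S s → Built S′ s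
  Built-resp S⊆S′ S′⊆S B = record
    { expr = expr ; vertex = vertex ; vertex-injective = vertex-injective
    ; vertex-∈ = λ x → S⊆S′ _ (vertex-∈ x) ; vertex-onto = λ v → vertex-onto v ∘ S′⊆S v
    ; edge-adj = edge-adj ; labelled = labelled }
    where open Built B

  Built-∅ : ∀ {S s} → (∀ v → S v → ⊥) → Built S s
  Built-∅ S-empty = record
    { expr = ε ; vertex = λ () ; vertex-injective = λ () ; vertex-∈ = λ ()
    ; vertex-onto = λ v Sv → ⊥-elim (S-empty v Sv) ; edge-adj = λ () ; labelled = Stage.hasLabels λ () }

  flatten : Fin 3 × Fin K → Fin 3 × Fin K
  flatten (p , _) = p , inject≤ 0F (m≤n⊔m k 2)

  InducedCW≤⇒Built : ∀ {S} → InducedCW≤ G S k → Built S 0F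
  InducedCW≤⇒Built (_ , e , f , f-injective , f-∈ , f-onto , e-adj) = record
    { expr = relabelAll (refine e (part ∘ f))
    ; vertex = f ; vertex-injective = f-injective ; vertex-∈ = f-∈ ; vertex-onto = f-onto
    ; edge-adj = λ x y → trans (edge-relabelAll _ x y) (trans (edge-refine e _ x y) (e-adj x y))
    ; labelled = Stage.hasLabels (Wide.label≡ (relabelAll-HasLabels refined)) }
    where
    open Wide.Relabelling flatten (λ _ → refl)
    refined : refine e (part ∘ f) Wide.HasLabels (λ x → part (f x) , inject≤ (label e x) (m≤m⊔n k 2))
    refined = Wide.hasLabels (label-refine e (part ∘ f))

  finish : Fin 3 × Fin 2 → Fin 3 × Fin 2
  finish (p , _) = p , 1F

  merge : ∀ {P Q} → Built P 1F → Built Q 0F → (∀ v → P v → Q v → ⊥) →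
          (∀ u v → P u → Q v → adj G u v ≡ (part v == s3 (part u))) →
          Built (λ v → P v ⊎ Q v) 1F
  merge {P} {Q} BP BQ disjoint across = record
    { expr = relabelAll joined
    ; vertex = vertex⊎ ∘ splitAt P.size
    ; vertex-injective = [,]′∘splitAt-injective P.vertex-injective Q.vertex-injective
        λ a b eq → disjoint _ (P.vertex-∈ a) (subst Q (sym eq) (Q.vertex-∈ b))
    ; vertex-∈ = vertex⊎-∈ ∘ splitAt P.size
    ; vertex-onto = vertex-onto
    ; edge-adj = λ x y → trans (edge-relabelAll joined x y)
        (trans (Stage.Joins.edge-joinAll attach attach-irrefl union-labelled x y) (union-edge x y))
    ; labelled = Stage.hasLabels λ x →
        trans (Stage.label≡ (relabelAll-HasLabels joined-labelled) x) (cong ι-stage (finish-stage (splitAt P.size x)))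
    }
    where
    module P = Built BP
    module Q = Built BQ
    open Stage.Relabelling finish (λ _ → refl)

    vertex⊎ : Fin P.size ⊎ Fin Q.size → Fin (n G)
    vertex⊎ = [ P.vertex , Q.vertex ]′

    stage : Fin P.size ⊎ Fin Q.size → Fin 3 × Fin 2
    stage = [ (λ a → part (P.vertex a) , 1F) , (λ b → part (Q.vertex b) , 0F) ]′

    union-labelled : (P.expr ⊕ Q.expr) Stage.HasLabels (stage ∘ splitAt P.size)
    union-labelled = Stage.⊕-HasLabels P.labelled Q.labelled

    joined : Expr L (P.size + Q.size)
    joined = Stage.Joins.joinAll attach attach-irrefl (P.expr ⊕ Q.expr)

    joined-labelled : joined Stage.HasLabels (stage ∘ splitAt P.size)
    joined-labelled = Stage.Joins.joinAll-HasLabels attach attach-irrefl union-labelled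

    finish-stage : ∀ s → finish (stage s) ≡ (part (vertex⊎ s) , 1F)
    finish-stage (inj₁ _) = refl
    finish-stage (inj₂ _) = refl

    vertex⊎-∈ : ∀ s → P (vertex⊎ s) ⊎ Q (vertex⊎ s)
    vertex⊎-∈ (inj₁ a) = inj₁ (P.vertex-∈ a)
    vertex⊎-∈ (inj₂ b) = inj₂ (Q.vertex-∈ b)

    vertex-onto : ∀ v → P v ⊎ Q v → ∃[ x ] vertex⊎ (splitAt P.size x) ≡ v
    vertex-onto v (inj₁ Pv) with a , refl ← P.vertex-onto v Pv =
      a ↑ˡ Q.size , cong vertex⊎ (splitAt-↑ˡ P.size a Q.size)
    vertex-onto v (inj₂ Qv) with b , refl ← Q.vertex-onto v Qv =
      P.size ↑ʳ b , cong vertex⊎ (splitAt-↑ʳ P.size Q.size b)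

    union-edge : ∀ x y →
      edge (P.expr ⊕ Q.expr) x y ∨ (attach (stage (splitAt P.size x)) (stage (splitAt P.size y))
                                    ∨ attach (stage (splitAt P.size y)) (stage (splitAt P.size x)))
      ≡ adj G (vertex⊎ (splitAt P.size x)) (vertex⊎ (splitAt P.size y))
    union-edge x y with splitAt P.size x | splitAt P.size y
    ... | inj₁ a | inj₁ b = trans (∨-identityʳ _) (P.edge-adj a b)
    ... | inj₂ a | inj₂ b = trans (∨-identityʳ _) (Q.edge-adj a b)
    ... | inj₁ a | inj₂ b = sym (across _ _ (P.vertex-∈ a) (Q.vertex-∈ b))
    ... | inj₂ a | inj₁ b = trans (∨-identityʳ _)
          (sym (trans (Graph.sym G _ _) (across _ _ (P.vertex-∈ b) (Q.vertex-∈ a))))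

module SliceAssembly (k : ℕ) (G : Graph) (part : Fin (n G) → Fin 3) (tri : IsTripartition G part)
                     (ℓ : ℕ) (slice : Fin (n G) → Fin (suc ℓ)) (sp : IsSlicePartition G part ℓ slice)
                     (slice-cw : ∀ j → InducedCW≤ G (λ v → slice v ≡ j) k) where
  open Assembly k G part

  adj-across-slices : ∀ u v → slice u < slice v → adj G u v ≡ (part v == s3 (part u))
  adj-across-slices u v u<v with part u | part v | tri u v | sp u v u<v
  ... | 0F | 0F | same | _                 = same refl
  ... | 0F | 1F | _    | complete , _      = complete refl
  ... | 0F | 2F | _    | _ , anticomplete  = anticomplete refl
  ... | 1F | 0F | _    | _ , anticomplete  = anticomplete refl
  ... | 1F | 1F | same | _                 = same refl
  ... | 1F | 2F | _    | complete , _      = complete refl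
  ... | 2F | 0F | _    | complete , _      = complete refl
  ... | 2F | 1F | _    | _ , anticomplete  = anticomplete refl
  ... | 2F | 2F | same | _                 = same refl

  Before : ℕ → Fin (n G) → Set
  Before t v = toℕ (slice v) <ℕ t

  built-before : ∀ t → t ≤ suc ℓ → Built (Before t) 1F
  built-before zero    _     = Built-∅ λ _ ()
  built-before (suc t) t<1+ℓ =
    Built-resp Before-∪ Before-split
      (merge (built-before t (<⇒≤ t<1+ℓ)) (InducedCW≤⇒Built (slice-cw j)) disjoint across)
    where
    j = fromℕ< t<1+ℓ
    toℕ-j : toℕ j ≡ t
    toℕ-j = toℕ-fromℕ< t<1+ℓ

    ∈j⇒≡t : ∀ {v} → slice v ≡ j → toℕ (slice v) ≡ t
    ∈j⇒≡t v∈j = trans (cong toℕ v∈j) toℕ-j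

    disjoint : ∀ v → Before t v → slice v ≡ j → ⊥
    disjoint v v<t v∈j = <-irrefl (∈j⇒≡t v∈j) v<t

    across : ∀ u v → Before t u → slice v ≡ j → adj G u v ≡ (part v == s3 (part u))
    across u v u<t v∈j =
      adj-across-slices u v (subst (toℕ (slice u) <ℕ_) (sym (∈j⇒≡t v∈j)) u<t)

    Before-∪ : ∀ v → Before t v ⊎ slice v ≡ j → Before (suc t) v
    Before-∪ v (inj₁ v<t)  = m<n⇒m<1+n v<t
    Before-∪ v (inj₂ v∈j)  = ≤-reflexive (cong suc (∈j⇒≡t v∈j))

    Before-split : ∀ v → Before (suc t) v → Before t v ⊎ slice v ≡ j
    Before-split v v<1+t = map₂ (λ v≡t → toℕ-injective (trans v≡t (sym toℕ-j))) (m<1+n⇒m<n∨m≡n v<1+t)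

lemma9 : (k : ℕ) → k ≥ 1 → (G : Graph) → (part : Fin (n G) → Fin 3) →
         IsTripartition G part → (ℓ : ℕ) → (slice : Fin (n G) → Fin (suc ℓ)) →
         IsSlicePartition G part ℓ slice →
         (∀ j → InducedCW≤ G (λ v → slice v ≡ j) k) →
         CW≤ G ((3 * k) ⊔ 6)
lemma9 k _ G part tri ℓ slice sp slice-cw =
  Built⇒InducedCW≤ (Built-resp (λ _ _ → tt) (λ v _ → toℕ<n (slice v)) (built-before (suc ℓ) ≤-refl))
  where
  open Assembly k G part
  open SliceAssembly k G part tri ℓ slice sp slice-cw
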